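{- Let $G$ be a graph, let $M^{\uparrow}$ be a strong module of $G$ with $|M^{\uparrow}|\ge2$, and let $X\subseteq M^{\uparrow}$ be such that $X$ intersects at least two modules of $\Pi_{mod}(G[M^{\uparrow}])$ and $G[X]$ is connected. Then for every $M\in\Pi_{mod}(G[M^{\uparrow}])$ with $X\cap M\ne\emptyset$ and every nonempty $Y\subseteq M$, the graph $G[(X\setminus M)\cup Y]$ is connected.
   Context: A module of a graph $H=(V,E)$ is $M\subseteq V$ with $N(v)\setminus M=N(w)\setminus M$ for all $v,w\in M$; it is strong if for every module $M'$: $M\cap M'=\emptyset$, $M\subseteq M'$ or $M'\subseteq M$. For a graph $H$ with at least two vertices, $\Pi_{mod}(H)$ is the partition of $V(H)$ into the inclusion-maximal strong modules of $H$ different from $V(H)$ (the children of $V(H)$ in the modular decomposition tree). -}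

module Defs where

open import Data.Nat using (ℕ)
open import Data.Fin using (Fin)
open import Data.Fin.Subset public using (Subset; _∈_; _∉_; _⊆_; _∩_; _∪_; ∁; ∣_∣; Nonempty)
open import Data.Product using (_×_; Σ; ∃; _,_)
open import Data.Sum using (_⊎_)
open import Relation.Nullary using (¬_)
open import Relation.Binary.PropositionalEquality using (_≡_)
open import Data.Empty using (⊥)

record Graph (n : ℕ) : Set₁ where
  field
    Adj   : Fin n → Fin n → Set
    sym   : ∀ {u v} → Adj u v → Adj v u
    irrefl : ∀ {u} → ¬ Adj u u
open Graph public

_∖_ : ∀ {n} → Subset n → Subset n → Subset n
A ∖ B = A ∩ ∁ B

IsModule : ∀ {n} → Graph n → Subset n → Subset n → Set
IsModule G U M =
  M ⊆ U ×
  (∀ v w → v ∈ M → w ∈ M → ∀ u → u ∈ U → u ∉ M →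
     (Adj G v u → Adj G w u) × (Adj G w u → Adj G v u))

IsStrongModule : ∀ {n} → Graph n → Subset n → Subset n → Set
IsStrongModule G U M =
  IsModule G U M ×
  (∀ M′ → IsModule G U M′ →
     (∀ x → x ∈ M → x ∈ M′ → ⊥) ⊎ (M ⊆ M′) ⊎ (M′ ⊆ M))

InΠmod : ∀ {n} → Graph n → Subset n → Subset n → Set
InΠmod G U M =
  IsStrongModule G U M × ¬ (M ≡ U) ×
  (∀ M′ → IsStrongModule G U M′ → ¬ (M′ ≡ U) → M ⊆ M′ → M′ ≡ M)

data Reach {n} (G : Graph n) (S : Subset n) : Fin n → Fin n → Set where
  here : ∀ {u} → u ∈ S → Reach G S u u
  step : ∀ {u v w} → u ∈ S → Adj G u v → Reach G S v w → Reach G S u w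

Connected : ∀ {n} → Graph n → Subset n → Set
Connected G S = ∀ u v → u ∈ S → v ∈ S → Reach G S u v

-- Fix y ∈ Y and send every vertex of M to y, leaving the other vertices fixed.
-- Since M is a module, a vertex outside M adjacent to some vertex of M is adjacent
-- to y, so this map sends paths of G[X] to paths of G[(X ∖ M) ∪ {y}].  Taking
-- y = u for u ∈ Y, the image of a path from a vertex of X ∩ M to a vertex of X ∖ M
-- joins u to X ∖ M, while vertices of X ∖ M stay connected among themselves.
-- It remains to see that X ∖ M is nonempty: two members of Π_mod(G[M↑]) that meet
-- are equal, so X, meeting two distinct ones, is not contained in M.
module Submission where

open import Defs
open import Data.Nat using (_≥_)
open import Data.Fin using (Fin)
open import Data.Fin.Subset using (⊤)
open import Data.Fin.Subset.Properties
  using (_∈?_; nonempty?; x∈p∩q⁺; x∈p∩q⁻; x∈p∪q⁺; x∈p∪q⁻; x∉p⇒x∈∁p; x∈∁p⇒x∉p)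
open import Data.Product using (_×_; Σ; _,_; proj₁; proj₂)
open import Data.Sum using (inj₁; inj₂)
open import Data.Empty using (⊥-elim)
open import Relation.Nullary using (¬_; yes; no; contradiction)
open import Relation.Binary.PropositionalEquality using (_≡_; refl; trans; subst₂) renaming (sym to ≡-sym)

Reach-trans : ∀ {n} {G : Graph n} {S u v w} →
  Reach G S u v → Reach G S v w → Reach G S u w
Reach-trans (here _)       q = q
Reach-trans (step u∈S e p) q = step u∈S e (Reach-trans p q)

Reach-source : ∀ {n} {G : Graph n} {S u v} → Reach G S u v → u ∈ S
Reach-source (here u∈S)     = u∈S
Reach-source (step u∈S _ _) = u∈S

InΠmod-meet⇒≡ : ∀ {n} {G : Graph n} {U M M′ x} →
  InΠmod G U M → InΠmod G U M′ → x ∈ M → x ∈ M′ → M ≡ M′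
InΠmod-meet⇒≡ {M = M} {M′} ((modM , strongM) , M≢U , maxM) ((modM′ , strongM′) , M′≢U , maxM′) x∈M x∈M′
  with strongM M′ modM′
... | inj₁ disjoint      = contradiction x∈M′ (disjoint _ x∈M)
... | inj₂ (inj₁ M⊆M′) = ≡-sym (maxM M′ (modM′ , strongM′) M′≢U M⊆M′)
... | inj₂ (inj₂ M′⊆M) = maxM′ M (modM , strongM) M≢U M′⊆M

∖-nonempty : ∀ {n} (X M : Subset n) → ¬ (X ⊆ M) → Nonempty (X ∖ M)
∖-nonempty X M X⊈M with nonempty? (X ∖ M)
... | yes X∖M≢∅ = X∖M≢∅
... | no  X∖M≡∅ = ⊥-elim (X⊈M X⊆M)
  where
    X⊆M : X ⊆ M
    X⊆M {x} x∈X with x ∈? M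
    ... | yes x∈M = x∈M
    ... | no  x∉M = contradiction (x , x∈p∩q⁺ (x∈X , x∉p⇒x∈∁p x∉M)) X∖M≡∅

meets-two-InΠmod⇒⊈ : ∀ {n} {G : Graph n} {U X M₁ M₂ M} →
  InΠmod G U M₁ → InΠmod G U M₂ → ¬ (M₁ ≡ M₂) →
  Nonempty (X ∩ M₁) → Nonempty (X ∩ M₂) → InΠmod G U M → ¬ (X ⊆ M)
meets-two-InΠmod⇒⊈ {G = G} {U} {X} {M = M} M₁∈Π M₂∈Π M₁≢M₂ X∩M₁≢∅ X∩M₂≢∅ M∈Π X⊆M =
  M₁≢M₂ (trans (≡M M₁∈Π X∩M₁≢∅) (≡-sym (≡M M₂∈Π X∩M₂≢∅)))
  where
    ≡M : ∀ {M′} → InΠmod G U M′ → Nonempty (X ∩ M′) → M′ ≡ M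
    ≡M {M′} M′∈Π (x , x∈X∩M′) with x∈p∩q⁻ X M′ x∈X∩M′
    ... | x∈X , x∈M′ = InΠmod-meet⇒≡ {G = G} M′∈Π M∈Π x∈M′ (X⊆M {x} x∈X)

module ModuleContraction {n} (G : Graph n) {U X M Y : Subset n}
  (modM : IsModule G U M) (X⊆U : X ⊆ U) (Y⊆M : Y ⊆ M) where

  S : Subset n
  S = (X ∖ M) ∪ Y

  ∈-X∖M : ∀ {u} → u ∈ X → ¬ u ∈ M → u ∈ S
  ∈-X∖M u∈X u∉M = x∈p∪q⁺ (inj₁ (x∈p∩q⁺ (u∈X , x∉p⇒x∈∁p u∉M)))

  ∈-Y : ∀ {u} → u ∈ Y → u ∈ S
  ∈-Y u∈Y = x∈p∪q⁺ (inj₂ u∈Y)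

  adj-transfer : ∀ {v w u} → v ∈ M → w ∈ M → u ∈ X → ¬ u ∈ M →
    Adj G v u → Adj G w u
  adj-transfer v∈M w∈M u∈X u∉M = proj₁ (proj₂ modM _ _ v∈M w∈M _ (X⊆U u∈X) u∉M)

  contract : Fin n → Fin n → Fin n
  contract y u with u ∈? M
  ... | yes _ = y
  ... | no  _ = u

  contract-∈ : ∀ {y u} → y ∈ Y → u ∈ X → contract y u ∈ S
  contract-∈ {u = u} y∈Y u∈X with u ∈? M
  ... | yes _   = ∈-Y y∈Y
  ... | no  u∉M = ∈-X∖M u∈X u∉M

  contract-outside : ∀ {y u} → ¬ u ∈ M → contract y u ≡ u
  contract-outside {u = u} u∉M with u ∈? M
  ... | yes u∈M = contradiction u∈M u∉M
  ... | no  _   = refl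

  contract-inside : ∀ {y u} → u ∈ M → contract y u ≡ y
  contract-inside {u = u} u∈M with u ∈? M
  ... | yes _   = refl
  ... | no  u∉M = contradiction u∈M u∉M

  contract-Reach : ∀ {y u v} → y ∈ Y → Reach G X u v → Reach G S (contract y u) (contract y v)
  contract-Reach y∈Y (here u∈X) = here (contract-∈ y∈Y u∈X)
  contract-Reach y∈Y (step {u} {w} u∈X e p) with u ∈? M | w ∈? M | contract-Reach y∈Y p
  ... | yes _   | yes _   | ih = ih
  ... | yes u∈M | no  w∉M | ih =
    step (∈-Y y∈Y) (adj-transfer u∈M (Y⊆M y∈Y) (Reach-source p) w∉M e) ih
  ... | no  u∉M | yes w∈M | ih =
    step (∈-X∖M u∈X u∉M) (Graph.sym G (adj-transfer w∈M (Y⊆M y∈Y) u∈X u∉M (Graph.sym G e))) ih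
  ... | no  u∉M | no  w∉M | ih =
    step (∈-X∖M u∈X u∉M) e ih

  ContractPreimage : Fin n → Set
  ContractPreimage u = Σ (Fin n) λ y → Σ (Fin n) λ s → y ∈ Y × s ∈ X × contract y s ≡ u

  contract-covers : ∀ {x u} → Nonempty Y → x ∈ X → x ∈ M → u ∈ S → ContractPreimage u
  contract-covers {x} {u} (y , y∈Y) x∈X x∈M u∈S with x∈p∪q⁻ (X ∖ M) Y u∈S
  ... | inj₂ u∈Y   = u , x , u∈Y , x∈X , contract-inside x∈M
  ... | inj₁ u∈X∖M with x∈p∩q⁻ X (∁ M) u∈X∖M
  ...   | u∈X , u∈∁M = y , u , y∈Y , u∈X , contract-outside (x∈∁p⇒x∉p u∈∁M)

  connected : ∀ {x z} → Connected G X → Nonempty Y →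
    x ∈ X → x ∈ M → z ∈ X → ¬ z ∈ M → Connected G S
  connected {z = z} conn Y≢∅ x∈X x∈M z∈X z∉M u v u∈S v∈S =
    Reach-trans (to-z (contract-covers Y≢∅ x∈X x∈M u∈S))
                (from-z (contract-covers Y≢∅ x∈X x∈M v∈S))
    where
      to-z : ∀ {u} → ContractPreimage u → Reach G S u z
      to-z (y , s , y∈Y , s∈X , eq) =
        subst₂ (Reach G S) eq (contract-outside z∉M) (contract-Reach y∈Y (conn s z s∈X z∈X))
      from-z : ∀ {v} → ContractPreimage v → Reach G S z v
      from-z (y , s , y∈Y , s∈X , eq) =
        subst₂ (Reach G S) (contract-outside z∉M) eq (contract-Reach y∈Y (conn z s z∈X s∈X))

lemma7 : ∀ {n} (G : Graph n) (Mup X : Subset n) →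
    IsStrongModule G ⊤ Mup →
    ∣ Mup ∣ ≥ 2 →
    X ⊆ Mup →
    (Σ (Subset n) λ M₁ → Σ (Subset n) λ M₂ →
      InΠmod G Mup M₁ × InΠmod G Mup M₂ × ¬ (M₁ ≡ M₂) ×
      Nonempty (X ∩ M₁) × Nonempty (X ∩ M₂)) →
    Connected G X →
    ∀ M → InΠmod G Mup M → Nonempty (X ∩ M) →
    ∀ Y → Y ⊆ M → Nonempty Y →
    Connected G ((X ∖ M) ∪ Y)
lemma7 G Mup X _ _ X⊆Mup (M₁ , M₂ , M₁∈Π , M₂∈Π , M₁≢M₂ , X∩M₁≢∅ , X∩M₂≢∅)
       conn M M∈Π (x , x∈X∩M) Y Y⊆M Y≢∅
  with ∖-nonempty X M (meets-two-InΠmod⇒⊈ {G = G} {X = X} M₁∈Π M₂∈Π M₁≢M₂ X∩M₁≢∅ X∩M₂≢∅ M∈Π)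
... | z , z∈X∖M with x∈p∩q⁻ X (∁ M) z∈X∖M | x∈p∩q⁻ X M x∈X∩M
...   | z∈X , z∈∁M | x∈X , x∈M =
  ModuleContraction.connected G (proj₁ (proj₁ M∈Π)) X⊆Mup Y⊆M
    conn Y≢∅ x∈X x∈M z∈X (x∈∁p⇒x∉p z∈∁M)
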